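{- For every $s\in\mathcal{Q}$, written $s=q/p$ with $p,q\in\mathbb{N}$ coprime, and every $n\in\mathbb{N}$, $$J_s+n\Lambda=\left\langle \{P^s_i\mid 0\le i<p+n\}\cup\{Q^s_j\mid 0\le j<q+n\}\right\rangle_s,$$ and $$J_s+\Lambda\ \supset\ \left[P^s_0+p\Lambda\right]\cup\left[Q^s_0+q\Lambda\right].$$
   Context: $\mathcal{Q}=\mathbb{Q}^{\ge0}\cup\{\infty\}$; each $s\in\mathcal{Q}$ is written uniquely $s=q/p$ with $p,q\in\mathbb{N}$ coprime (with $\infty=1/0$). For such $s$: $J_s=\{(\alpha,\beta)\in\mathbb{Z}^2:\ \alpha\equiv q,\ \beta\equiv p \pmod 2;\ \alpha\ge-q;\ \beta\ge-p;\ \alpha+\beta\le p+q-2;\ p\alpha+q\beta\ge0\}$; $Z_s=(q,p)+2\mathbb{Z}^2$; $P^s_i=(q+2i,-p)$, $Q^s_j=(-q,p+2j)$ for $i,j\in\mathbb{Z}$; for $U\subset Z_s$, $\langle U\rangle_s$ is the intersection with $Z_s$ of the convex hull of $U$ in $\mathbb{R}^2$. $\Lambda=\{(0,0),(0,2),(2,0)\}$ and $n\Lambda=\Lambda+\dots+\Lambda$ ($n$ terms, Minkowski sum) $=\{(2i,2j)\in2\mathbb{N}^2: i+j\le n\}$. Sums of subsets of $\mathbb{Z}^2$ (and of a point and a subset) are Minkowski sums. -}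

module Defs where

open import Data.Nat using (ℕ; zero; suc)
open import Data.Integer as ℤ using (ℤ; +_)
open import Data.Rational as ℚ using (ℚ)
open import Data.Product using (_×_; _,_; ∃; ∃-syntax; Σ)
open import Data.Sum using (_⊎_)
open import Data.List using (List; map; foldr)
open import Data.List.Relation.Unary.All using (All)
open import Relation.Binary.PropositionalEquality using (_≡_)
open import Level using (0ℓ)

Pt : Set
Pt = ℤ × ℤ

PSet : Set₁
PSet = Pt → Set

_⊕_ : Pt → Pt → Pt
(a , b) ⊕ (c , d) = (a ℤ.+ c , b ℤ.+ d)

_+ₛ_ : PSet → PSet → PSet
(A +ₛ B) x = ∃[ a ] ∃[ b ] (A a × B b × x ≡ a ⊕ b)

_+ₚ_ : Pt → PSet → PSet
(v +ₚ B) x = ∃[ b ] (B b × x ≡ v ⊕ b)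

_∪ₛ_ : PSet → PSet → PSet
(A ∪ₛ B) x = A x ⊎ B x

_⊆ₛ_ : PSet → PSet → Set
A ⊆ₛ B = ∀ x → A x → B x

_≐_ : PSet → PSet → Set
A ≐ B = (A ⊆ₛ B) × (B ⊆ₛ A)

infix 4 _≡₂_
_≡₂_ : ℤ → ℤ → Set
a ≡₂ b = ∃[ k ] (a ≡ b ℤ.+ (+ 2) ℤ.* k)

Λ : PSet
Λ x = (x ≡ (+ 0 , + 0)) ⊎ (x ≡ (+ 0 , + 2)) ⊎ (x ≡ (+ 2 , + 0))

_·Λ : ℕ → PSet
(zero ·Λ) x = x ≡ (+ 0 , + 0)
(suc n ·Λ) = Λ +ₛ (n ·Λ)

-- J_s for s = q/p
J : (q p : ℕ) → PSet
J q p (α , β) =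
  (α ≡₂ + q) × (β ≡₂ + p)
  × (ℤ.- (+ q) ℤ.≤ α) × (ℤ.- (+ p) ℤ.≤ β)
  × (α ℤ.+ β ℤ.≤ (+ p ℤ.+ + q) ℤ.- + 2)
  × (+ 0 ℤ.≤ (+ p) ℤ.* α ℤ.+ (+ q) ℤ.* β)

Z : (q p : ℕ) → PSet
Z q p (α , β) = (α ≡₂ + q) × (β ≡₂ + p)

P : (q p : ℕ) → ℤ → Pt
P q p i = (+ q ℤ.+ (+ 2) ℤ.* i , ℤ.- (+ p))

Q : (q p : ℕ) → ℤ → Pt
Q q p j = (ℤ.- (+ q) , + p ℤ.+ (+ 2) ℤ.* j)

ℤ→ℚ : ℤ → ℚ
ℤ→ℚ z = z ℚ./ 1

ConvHull : PSet → PSet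
ConvHull U (α , β) = Σ (List (ℚ × Pt)) λ L →
    All (λ wu → (ℚ.0ℚ ℚ.≤ Data.Product.proj₁ wu) × U (Data.Product.proj₂ wu)) L
  × foldr (λ wu acc → Data.Product.proj₁ wu ℚ.+ acc) ℚ.0ℚ L ≡ ℚ.1ℚ
  × foldr (λ wu acc → Data.Product.proj₁ wu ℚ.* ℤ→ℚ (Data.Product.proj₁ (Data.Product.proj₂ wu)) ℚ.+ acc) ℚ.0ℚ L ≡ ℤ→ℚ α
  × foldr (λ wu acc → Data.Product.proj₁ wu ℚ.* ℤ→ℚ (Data.Product.proj₂ (Data.Product.proj₂ wu)) ℚ.+ acc) ℚ.0ℚ L ≡ ℤ→ℚ β

⟨_⟩[_,_] : PSet → ℕ → ℕ → PSet
⟨ U ⟩[ q , p ] x = Z q p x × ConvHull U x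

Gen : (q p n : ℕ) → PSet
Gen q p n x =
    (∃[ i ] ((+ 0 ℤ.≤ i) × (i ℤ.< + (p Data.Nat.+ n)) × x ≡ P q p i))
  ⊎ (∃[ j ] ((+ 0 ℤ.≤ j) × (j ℤ.< + (q Data.Nat.+ n)) × x ≡ Q q p j))

-- In the chart (a, b) ↦ (2a − q, 2b − p), which identifies ℕ² with the points of Z_s in the
-- quadrant α ≥ −q, β ≥ −p, both sides of the equality become the set of lattice points of the
-- polygon a + b < p + q + n, p a + q b ≥ p q.
-- For J_s + nΛ this is proved one unit of n at a time: a point of the polygon for n + 1 outside
-- the polygon for n can be moved one step towards an axis into the polygon for n.
-- The generators are the lattice points of the polygon on the two axes. They satisfy the linear
-- inequalities cutting out the polygon, hence so does their convex hull; conversely every lattice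
-- point of the polygon is an explicit combination, with natural weights, of at most three generators.
-- The corner inclusions hold because P_0 + pΛ and Q_0 + qΛ lie in the polygon for n = 1.
-- Coprimality is needed only when p = 0 or q = 0, where it forces the other to be 1.
module Submission where

open import Defs
open import Data.Nat as ℕ using (ℕ; zero; suc; z≤n; s≤s; _+_; _*_; _∸_; _≤_; _<_; pred)
open import Data.Nat.Properties
import Data.Nat.Tactic.RingSolver as ℕSolver
open import Data.Nat.Coprimality as Coprimality using (Coprime; 0-coprimeTo-m⇒m≡1)
open import Data.Integer as ℤ using (ℤ; +_; -[1+_])
import Data.Integer.Properties as ℤP
import Data.Integer.Tactic.RingSolver as ℤSolver
open import Data.Rational as ℚ using (ℚ; mkℚ)
import Data.Rational.Properties as ℚP
open import Data.Rational.Solver using (module +-*-Solver)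
open import Data.Product using (_×_; _,_; ∃; ∃₂; proj₁; proj₂; map₁; map₂; swap; uncurry)
open import Data.Sum using (_⊎_; inj₁; inj₂)
open import Data.List using (List; []; _∷_; foldr; map)
open import Data.List.Relation.Unary.All as All using (All; []; _∷_)
import Data.List.Relation.Unary.All.Properties as All
open import Function using (_∘_; _⇔_; mk⇔; Equivalence)
open import Relation.Nullary using (yes; no; contradiction)
open import Relation.Binary.PropositionalEquality hiding (J)

open Equivalence using (to; from)

ℤ→ℚ≡mkℚ : ∀ z → ℤ→ℚ z ≡ mkℚ z 0 (Coprimality.sym (Coprimality.1-coprimeTo _))
ℤ→ℚ≡mkℚ z = ℚP.↥p/↧p≡p (mkℚ z 0 _)

ℤ→ℚ-homo-+ : ∀ x y → ℤ→ℚ (x ℤ.+ y) ≡ ℤ→ℚ x ℚ.+ ℤ→ℚ y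
ℤ→ℚ-homo-+ x y = begin
  ℤ→ℚ (x ℤ.+ y)                      ≡⟨ cong (ℚ._/ 1) (x+y≡x*1+y*1 x y) ⟩
  (x ℤ.* + 1 ℤ.+ y ℤ.* + 1) ℚ./ 1    ≡⟨ cong₂ ℚ._+_ (ℤ→ℚ≡mkℚ x) (ℤ→ℚ≡mkℚ y) ⟨
  ℤ→ℚ x ℚ.+ ℤ→ℚ y                    ∎
  where
  open ≡-Reasoning
  x+y≡x*1+y*1 : ∀ x y → x ℤ.+ y ≡ x ℤ.* + 1 ℤ.+ y ℤ.* + 1
  x+y≡x*1+y*1 = ℤSolver.solve-∀

ℤ→ℚ-homo-* : ∀ x y → ℤ→ℚ (x ℤ.* y) ≡ ℤ→ℚ x ℚ.* ℤ→ℚ y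
ℤ→ℚ-homo-* x y = sym (cong₂ ℚ._*_ (ℤ→ℚ≡mkℚ x) (ℤ→ℚ≡mkℚ y))

ℤ→ℚ-mono-≤ : ∀ {x y} → x ℤ.≤ y → ℤ→ℚ x ℚ.≤ ℤ→ℚ y
ℤ→ℚ-mono-≤ {x} {y} x≤y = subst₂ ℚ._≤_ (sym (ℤ→ℚ≡mkℚ x)) (sym (ℤ→ℚ≡mkℚ y))
  (ℚ.*≤* (subst₂ ℤ._≤_ (sym (ℤP.*-identityʳ x)) (sym (ℤP.*-identityʳ y)) x≤y))

ℤ→ℚ-cancel-≤ : ∀ {x y} → ℤ→ℚ x ℚ.≤ ℤ→ℚ y → x ℤ.≤ y
ℤ→ℚ-cancel-≤ {x} {y} x≤y with subst₂ ℚ._≤_ (ℤ→ℚ≡mkℚ x) (ℤ→ℚ≡mkℚ y) x≤y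
... | ℚ.*≤* x*1≤y*1 = subst₂ ℤ._≤_ (ℤP.*-identityʳ x) (ℤP.*-identityʳ y) x*1≤y*1

weight : List (ℚ × Pt) → ℚ
weight = foldr (λ wu acc → proj₁ wu ℚ.+ acc) ℚ.0ℚ

weightedSum : (Pt → ℤ) → List (ℚ × Pt) → ℚ
weightedSum f = foldr (λ wu acc → proj₁ wu ℚ.* ℤ→ℚ (f (proj₂ wu)) ℚ.+ acc) ℚ.0ℚ

linearForm : ℤ → ℤ → Pt → ℤ
linearForm u v x = u ℤ.* proj₁ x ℤ.+ v ℤ.* proj₂ x

weightedSum-linearForm : ∀ u v L → weightedSum (linearForm u v) L
  ≡ ℤ→ℚ u ℚ.* weightedSum proj₁ L ℚ.+ ℤ→ℚ v ℚ.* weightedSum proj₂ L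
weightedSum-linearForm u v [] = sym (cong₂ ℚ._+_ (ℚP.*-zeroʳ (ℤ→ℚ u)) (ℚP.*-zeroʳ (ℤ→ℚ v)))
weightedSum-linearForm u v ((w , (x , y)) ∷ L) = begin
  w ℚ.* ℤ→ℚ (u ℤ.* x ℤ.+ v ℤ.* y) ℚ.+ weightedSum (linearForm u v) L
    ≡⟨ cong₂ (λ s t → w ℚ.* s ℚ.+ t)
         (trans (ℤ→ℚ-homo-+ (u ℤ.* x) (v ℤ.* y)) (cong₂ ℚ._+_ (ℤ→ℚ-homo-* u x) (ℤ→ℚ-homo-* v y)))
         (weightedSum-linearForm u v L) ⟩
  w ℚ.* (ℤ→ℚ u ℚ.* ℤ→ℚ x ℚ.+ ℤ→ℚ v ℚ.* ℤ→ℚ y) ℚ.+ (ℤ→ℚ u ℚ.* X ℚ.+ ℤ→ℚ v ℚ.* Y)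
    ≡⟨ regroup w (ℤ→ℚ u) (ℤ→ℚ v) (ℤ→ℚ x) (ℤ→ℚ y) X Y ⟩
  ℤ→ℚ u ℚ.* (w ℚ.* ℤ→ℚ x ℚ.+ X) ℚ.+ ℤ→ℚ v ℚ.* (w ℚ.* ℤ→ℚ y ℚ.+ Y) ∎
  where
  open ≡-Reasoning
  open +-*-Solver
  X = weightedSum proj₁ L
  Y = weightedSum proj₂ L
  regroup : ∀ w u v x y X Y → w ℚ.* (u ℚ.* x ℚ.+ v ℚ.* y) ℚ.+ (u ℚ.* X ℚ.+ v ℚ.* Y)
                            ≡ u ℚ.* (w ℚ.* x ℚ.+ X) ℚ.+ v ℚ.* (w ℚ.* y ℚ.+ Y)
  regroup = solve 7 (λ w u v x y X Y → w :* (u :* x :+ v :* y) :+ (u :* X :+ v :* Y)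
                                    := u :* (w :* x :+ X) :+ v :* (w :* y :+ Y)) refl

weightedSum-lowerBound : ∀ (f : Pt → ℤ) c L →
  All (λ wu → (ℚ.0ℚ ℚ.≤ proj₁ wu) × (c ℤ.≤ f (proj₂ wu))) L →
  ℤ→ℚ c ℚ.* weight L ℚ.≤ weightedSum f L
weightedSum-lowerBound f c [] [] = ℚP.≤-reflexive (ℚP.*-zeroʳ (ℤ→ℚ c))
weightedSum-lowerBound f c ((w , x) ∷ L) ((0≤w , c≤fx) ∷ bounds) = begin
  ℤ→ℚ c ℚ.* (w ℚ.+ weight L)               ≡⟨ ℚP.*-distribˡ-+ (ℤ→ℚ c) w (weight L) ⟩
  ℤ→ℚ c ℚ.* w ℚ.+ ℤ→ℚ c ℚ.* weight L       ≡⟨ cong (ℚ._+ _) (ℚP.*-comm (ℤ→ℚ c) w) ⟩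
  w ℚ.* ℤ→ℚ c ℚ.+ ℤ→ℚ c ℚ.* weight L       ≤⟨ ℚP.+-mono-≤ (ℚP.*-monoˡ-≤-nonNeg w {{ℚ.nonNegative 0≤w}} (ℤ→ℚ-mono-≤ c≤fx))
                                                            (weightedSum-lowerBound f c L bounds) ⟩
  w ℚ.* ℤ→ℚ (f x) ℚ.+ weightedSum f L      ∎
  where open ℚP.≤-Reasoning

ConvHull-lowerBound : ∀ {U : PSet} u v c {α β} →
  (∀ x → U x → c ℤ.≤ linearForm u v x) →
  ConvHull U (α , β) → c ℤ.≤ linearForm u v (α , β)
ConvHull-lowerBound u v c {α} {β} bound (L , members , weight≡1 , sum₁≡α , sum₂≡β) =
  ℤ→ℚ-cancel-≤ (begin
    ℤ→ℚ c                                        ≡⟨ ℚP.*-identityʳ (ℤ→ℚ c) ⟨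
    ℤ→ℚ c ℚ.* ℚ.1ℚ                               ≡⟨ cong (ℤ→ℚ c ℚ.*_) weight≡1 ⟨
    ℤ→ℚ c ℚ.* weight L                           ≤⟨ weightedSum-lowerBound (linearForm u v) c L
                                                       (All.map (λ (0≤w , Ux) → 0≤w , bound _ Ux) members) ⟩
    weightedSum (linearForm u v) L               ≡⟨ weightedSum-linearForm u v L ⟩
    ℤ→ℚ u ℚ.* weightedSum proj₁ L ℚ.+ ℤ→ℚ v ℚ.* weightedSum proj₂ L
                                                 ≡⟨ cong₂ (λ s t → ℤ→ℚ u ℚ.* s ℚ.+ ℤ→ℚ v ℚ.* t) sum₁≡α sum₂≡β ⟩
    ℤ→ℚ u ℚ.* ℤ→ℚ α ℚ.+ ℤ→ℚ v ℚ.* ℤ→ℚ β          ≡⟨ cong₂ ℚ._+_ (ℤ→ℚ-homo-* u α) (ℤ→ℚ-homo-* v β) ⟨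
    ℤ→ℚ (u ℤ.* α) ℚ.+ ℤ→ℚ (v ℤ.* β)              ≡⟨ ℤ→ℚ-homo-+ (u ℤ.* α) (v ℤ.* β) ⟨
    ℤ→ℚ (linearForm u v (α , β))                 ∎)
  where open ℚP.≤-Reasoning

mass : {A : Set} → List (ℕ × A) → ℕ
mass = foldr (λ cx acc → proj₁ cx + acc) 0

momentℤ : (Pt → ℤ) → List (ℕ × Pt) → ℤ
momentℤ f = foldr (λ cx acc → + proj₁ cx ℤ.* f (proj₂ cx) ℤ.+ acc) (+ 0)

module _ (r : ℚ) where
  open +-*-Solver
  open ≡-Reasoning

  rescale : List (ℕ × Pt) → List (ℚ × Pt)
  rescale = map (map₁ (λ c → ℤ→ℚ (+ c) ℚ.* r))

  weight-rescale : ∀ L → weight (rescale L) ≡ r ℚ.* ℤ→ℚ (+ mass L)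
  weight-rescale [] = sym (ℚP.*-zeroʳ r)
  weight-rescale ((c , x) ∷ L) = begin
    C ℚ.* r ℚ.+ weight (rescale L)  ≡⟨ cong (C ℚ.* r ℚ.+_) (weight-rescale L) ⟩
    C ℚ.* r ℚ.+ r ℚ.* M             ≡⟨ factor C r M ⟩
    r ℚ.* (C ℚ.+ M)                 ≡⟨ cong (r ℚ.*_) (ℤ→ℚ-homo-+ (+ c) (+ mass L)) ⟨
    r ℚ.* ℤ→ℚ (+ (c + mass L))      ∎
    where
    C = ℤ→ℚ (+ c)
    M = ℤ→ℚ (+ mass L)
    factor : ∀ C r M → C ℚ.* r ℚ.+ r ℚ.* M ≡ r ℚ.* (C ℚ.+ M)
    factor = solve 3 (λ C r M → C :* r :+ r :* M := r :* (C :+ M)) refl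

  weightedSum-rescale : ∀ f L → weightedSum f (rescale L) ≡ r ℚ.* ℤ→ℚ (momentℤ f L)
  weightedSum-rescale f [] = sym (ℚP.*-zeroʳ r)
  weightedSum-rescale f ((c , x) ∷ L) = begin
    C ℚ.* r ℚ.* F ℚ.+ weightedSum f (rescale L)  ≡⟨ cong (C ℚ.* r ℚ.* F ℚ.+_) (weightedSum-rescale f L) ⟩
    C ℚ.* r ℚ.* F ℚ.+ r ℚ.* S                    ≡⟨ factor C r F S ⟩
    r ℚ.* (C ℚ.* F ℚ.+ S)                        ≡⟨ cong (λ t → r ℚ.* (t ℚ.+ S)) (ℤ→ℚ-homo-* (+ c) (f x)) ⟨
    r ℚ.* (ℤ→ℚ (+ c ℤ.* f x) ℚ.+ S)              ≡⟨ cong (r ℚ.*_) (ℤ→ℚ-homo-+ (+ c ℤ.* f x) (momentℤ f L)) ⟨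
    r ℚ.* ℤ→ℚ (+ c ℤ.* f x ℤ.+ momentℤ f L)      ∎
    where
    C = ℤ→ℚ (+ c)
    F = ℤ→ℚ (f x)
    S = ℤ→ℚ (momentℤ f L)
    factor : ∀ C r F S → C ℚ.* r ℚ.* F ℚ.+ r ℚ.* S ≡ r ℚ.* (C ℚ.* F ℚ.+ S)
    factor = solve 4 (λ C r F S → C :* r :* F :+ r :* S := r :* (C :* F :+ S)) refl

barycentre∈ConvHull : ∀ {U : PSet} {α β} L d →
  All (U ∘ proj₂) L → mass L ≡ suc d →
  momentℤ proj₁ L ≡ + suc d ℤ.* α → momentℤ proj₂ L ≡ + suc d ℤ.* β →
  ConvHull U (α , β)
barycentre∈ConvHull {α = α} {β} L d members mass≡ moment₁≡ moment₂≡ =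
  rescale r L ,
  All.map⁺ (All.map (λ {cx} Ux → nonNegative (proj₁ cx) , Ux) members) ,
  (begin
    weight (rescale r L)            ≡⟨ weight-rescale r L ⟩
    r ℚ.* ℤ→ℚ (+ mass L)            ≡⟨ cong (λ m → r ℚ.* ℤ→ℚ (+ m)) mass≡ ⟩
    r ℚ.* ℤ→ℚ (+ suc d)             ≡⟨ cong (λ z → r ℚ.* ℤ→ℚ z) (ℤP.*-identityʳ (+ suc d)) ⟨
    r ℚ.* ℤ→ℚ (+ suc d ℤ.* + 1)     ≡⟨ divide (+ 1) ⟩
    ℚ.1ℚ                            ∎) ,
  trans (weightedSum-rescale r proj₁ L) (trans (cong (λ z → r ℚ.* ℤ→ℚ z) moment₁≡) (divide α)) ,
  trans (weightedSum-rescale r proj₂ L) (trans (cong (λ z → r ℚ.* ℤ→ℚ z) moment₂≡) (divide β))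
  where
  open ≡-Reasoning
  D : ℚ
  D = mkℚ (+ suc d) 0 (Coprimality.sym (Coprimality.1-coprimeTo _))
  r : ℚ
  r = ℚ.1/ D
  divide : ∀ z → r ℚ.* ℤ→ℚ (+ suc d ℤ.* z) ≡ ℤ→ℚ z
  divide z = begin
    r ℚ.* ℤ→ℚ (+ suc d ℤ.* z)        ≡⟨ cong (r ℚ.*_) (ℤ→ℚ-homo-* (+ suc d) z) ⟩
    r ℚ.* (ℤ→ℚ (+ suc d) ℚ.* ℤ→ℚ z)  ≡⟨ cong (λ x → r ℚ.* (x ℚ.* ℤ→ℚ z)) (ℤ→ℚ≡mkℚ (+ suc d)) ⟩
    r ℚ.* (D ℚ.* ℤ→ℚ z)              ≡⟨ ℚP.*-assoc r D (ℤ→ℚ z) ⟨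
    r ℚ.* D ℚ.* ℤ→ℚ z                ≡⟨ cong (ℚ._* ℤ→ℚ z) (ℚP.*-inverseˡ D) ⟩
    ℚ.1ℚ ℚ.* ℤ→ℚ z                   ≡⟨ ℚP.*-identityˡ (ℤ→ℚ z) ⟩
    ℤ→ℚ z                            ∎
  nonNegative : ∀ c → ℚ.0ℚ ℚ.≤ ℤ→ℚ (+ c) ℚ.* r
  nonNegative c = subst (ℚ._≤ ℤ→ℚ (+ c) ℚ.* r) (ℚP.*-zeroˡ r)
    (ℚP.*-monoʳ-≤-nonNeg r (ℤ→ℚ-mono-≤ (ℤ.+≤+ (z≤n {c}))))

offset : ℕ → ℕ → ℤ
offset k a = ℤ.- + k ℤ.+ + 2 ℤ.* + a

chart : ℕ → ℕ → ℕ → ℕ → Pt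
chart q p a b = (offset q a , offset p b)

ChartImage : ℕ → ℕ → (ℕ → ℕ → Set) → PSet
ChartImage q p R x = ∃₂ λ a b → R a b × x ≡ chart q p a b

offset-≡₂ : ∀ k a → offset k a ≡₂ + k
offset-≡₂ k a = + a ℤ.- + k , shift (+ k) (+ a)
  where
  shift : ∀ k a → ℤ.- k ℤ.+ + 2 ℤ.* a ≡ k ℤ.+ + 2 ℤ.* (a ℤ.- k)
  shift = ℤSolver.solve-∀

offset-lowerBound : ∀ k a → ℤ.- + k ℤ.≤ offset k a
offset-lowerBound k a = subst (λ t → ℤ.- + k ℤ.≤ ℤ.- + k ℤ.+ t) (ℤP.pos-* 2 a) (ℤP.i≤i+j (ℤ.- + k) (+ (2 * a)))

offset-surjective : ∀ k {α} → α ≡₂ + k → ℤ.- + k ℤ.≤ α → ∃ λ a → α ≡ offset k a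
offset-surjective k {α} (t , α≡k+2t) -k≤α = natural (t ℤ.+ + k) 0≤2[t+k] α≡
  where
  recentre : ∀ k t → k ℤ.+ + 2 ℤ.* t ≡ ℤ.- k ℤ.+ + 2 ℤ.* (t ℤ.+ k)
  recentre = ℤSolver.solve-∀
  cancel : ∀ k s → ℤ.- k ℤ.+ s ℤ.- ℤ.- k ≡ s
  cancel = ℤSolver.solve-∀
  α≡ : α ≡ ℤ.- + k ℤ.+ + 2 ℤ.* (t ℤ.+ + k)
  α≡ = trans α≡k+2t (recentre (+ k) t)
  0≤2[t+k] : + 0 ℤ.≤ + 2 ℤ.* (t ℤ.+ + k)
  0≤2[t+k] = subst (+ 0 ℤ.≤_) (trans (cong (ℤ._- ℤ.- + k) α≡) (cancel (+ k) _)) (ℤP.i≤j⇒0≤j-i -k≤α)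
  natural : ∀ s → + 0 ℤ.≤ + 2 ℤ.* s → α ≡ ℤ.- + k ℤ.+ + 2 ℤ.* s → ∃ λ a → α ≡ offset k a
  natural (+ a) _ α≡ = a , α≡
  natural -[1+ m ] () _

difference-≤⇔ : ∀ {L R : ℤ} {x y : ℕ} → R ℤ.- L ≡ + 2 ℤ.* (+ x ℤ.- + y) → (L ℤ.≤ R) ⇔ (y ≤ x)
difference-≤⇔ {x = x} {y} R-L≡ = mk⇔
  (λ L≤R → ℤP.drop‿+≤+ (ℤP.0≤i-j⇒j≤i (ℤP.*-cancelˡ-≤-pos (+ 0) (+ x ℤ.- + y) (+ 2)
             (subst (+ 0 ℤ.≤_) R-L≡ (ℤP.i≤j⇒0≤j-i L≤R)))))
  (λ y≤x → ℤP.0≤i-j⇒j≤i (subst (+ 0 ℤ.≤_) (sym R-L≡)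
             (ℤP.*-monoˡ-≤-nonNeg (+ 2) (ℤP.i≤j⇒0≤j-i (ℤ.+≤+ y≤x)))))

OuterBound : ℕ → ℕ → ℕ → Pt → Set
OuterBound q p n (α , β) = α ℤ.+ β ℤ.≤ (+ p ℤ.+ + q) ℤ.- + 2 ℤ.+ + 2 ℤ.* + n

InnerBound : ℕ → ℕ → Pt → Set
InnerBound q p (α , β) = + 0 ℤ.≤ + p ℤ.* α ℤ.+ + q ℤ.* β

record Polygon (q p n a b : ℕ) : Set where
  constructor polygon
  field
    outer : a + b < p + q + n
    inner : q * p ≤ p * a + q * b

chart-OuterBound : ∀ q p n a b → OuterBound q p n (chart q p a b) ⇔ (a + b < p + q + n)
chart-OuterBound q p n a b = difference-≤⇔ (identity (+ q) (+ p) (+ n) (+ a) (+ b))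
  where
  identity : ∀ q p n a b →
    ((p ℤ.+ q) ℤ.- + 2 ℤ.+ + 2 ℤ.* n) ℤ.- ((ℤ.- q ℤ.+ + 2 ℤ.* a) ℤ.+ (ℤ.- p ℤ.+ + 2 ℤ.* b))
    ≡ + 2 ℤ.* ((p ℤ.+ q ℤ.+ n) ℤ.- (+ 1 ℤ.+ (a ℤ.+ b)))
  identity = ℤSolver.solve-∀

chart-InnerBound : ∀ q p a b → InnerBound q p (chart q p a b) ⇔ (q * p ≤ p * a + q * b)
chart-InnerBound q p a b = difference-≤⇔ (trans (identity (+ q) (+ p) (+ a) (+ b))
  (cong₂ (λ s t → + 2 ℤ.* (s ℤ.- t))
         (sym (cong₂ ℤ._+_ (ℤP.pos-* p a) (ℤP.pos-* q b))) (sym (ℤP.pos-* q p))))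
  where
  identity : ∀ q p a b →
    (p ℤ.* (ℤ.- q ℤ.+ + 2 ℤ.* a) ℤ.+ q ℤ.* (ℤ.- p ℤ.+ + 2 ℤ.* b)) ℤ.- + 0
    ≡ + 2 ℤ.* ((p ℤ.* a ℤ.+ q ℤ.* b) ℤ.- q ℤ.* p)
  identity = ℤSolver.solve-∀

P≡chart : ∀ q p k → P q p (+ k) ≡ chart q p (q + k) 0
P≡chart q p k = cong₂ _,_ (recentre (+ q) (+ k)) (sym (ℤP.+-identityʳ (ℤ.- + p)))
  where
  recentre : ∀ q k → q ℤ.+ + 2 ℤ.* k ≡ ℤ.- q ℤ.+ + 2 ℤ.* (q ℤ.+ k)
  recentre = ℤSolver.solve-∀

Q≡chart : ∀ q p k → Q q p (+ k) ≡ chart q p 0 (p + k)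
Q≡chart q p k = cong₂ _,_ (sym (ℤP.+-identityʳ (ℤ.- + q))) (recentre (+ p) (+ k))
  where
  recentre : ∀ p k → p ℤ.+ + 2 ℤ.* k ≡ ℤ.- p ℤ.+ + 2 ℤ.* (p ℤ.+ k)
  recentre = ℤSolver.solve-∀

J⊆Polygon : ∀ q p → J q p ⊆ₛ ChartImage q p (Polygon q p 0)
J⊆Polygon q p (α , β) (α≡₂q , β≡₂p , -q≤α , -p≤β , α+β≤ , 0≤pα+qβ)
  with offset-surjective q α≡₂q -q≤α | offset-surjective p β≡₂p -p≤β
... | a , refl | b , refl =
  a , b , polygon (to (chart-OuterBound q p 0 a b) (subst (offset q a ℤ.+ offset p b ℤ.≤_) (sym (ℤP.+-identityʳ _)) α+β≤))
                  (to (chart-InnerBound q p a b) 0≤pα+qβ) , refl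

Polygon⇒J : ∀ q p {a b} → Polygon q p 0 a b → J q p (chart q p a b)
Polygon⇒J q p {a} {b} (polygon a+b<N qp≤pa+qb) =
  offset-≡₂ q a , offset-≡₂ p b , offset-lowerBound q a , offset-lowerBound p b ,
  subst (offset q a ℤ.+ offset p b ℤ.≤_) (ℤP.+-identityʳ _) (from (chart-OuterBound q p 0 a b) a+b<N) ,
  from (chart-InnerBound q p a b) qp≤pa+qb

doubled : ℕ → ℕ → Pt
doubled i j = (+ 2 ℤ.* + i , + 2 ℤ.* + j)

2+2*n≡2*[1+n] : ∀ n → + 2 ℤ.+ + 2 ℤ.* + n ≡ + 2 ℤ.* + suc n
2+2*n≡2*[1+n] n = identity (+ n)
  where
  identity : ∀ n → + 2 ℤ.+ + 2 ℤ.* n ≡ + 2 ℤ.* (+ 1 ℤ.+ n)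
  identity = ℤSolver.solve-∀

·Λ⇒doubled : ∀ n {z} → (n ·Λ) z → ∃₂ λ i j → i + j ≤ n × z ≡ doubled i j
·Λ⇒doubled zero refl = 0 , 0 , z≤n , refl
·Λ⇒doubled (suc n) (u , v , u∈Λ , v∈nΛ , refl) with ·Λ⇒doubled n v∈nΛ
... | i , j , i+j≤n , refl with u∈Λ
...   | inj₁ refl = i , j , m≤n⇒m≤1+n i+j≤n , cong₂ _,_ (ℤP.+-identityˡ _) (ℤP.+-identityˡ _)
...   | inj₂ (inj₁ refl) = i , suc j , subst (_≤ suc n) (sym (+-suc i j)) (s≤s i+j≤n) ,
                            cong₂ _,_ (ℤP.+-identityˡ _) (2+2*n≡2*[1+n] j)
...   | inj₂ (inj₂ refl) = suc i , j , s≤s i+j≤n , cong₂ _,_ (2+2*n≡2*[1+n] i) (ℤP.+-identityˡ _)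

doubled∈·Λ : ∀ n i j → i + j ≤ n → (n ·Λ) (doubled i j)
doubled∈·Λ zero zero zero z≤n = refl
doubled∈·Λ (suc n) zero zero _ = _ , _ , inj₁ refl , doubled∈·Λ n 0 0 z≤n , refl
doubled∈·Λ (suc n) zero (suc j) (s≤s j≤n) =
  _ , _ , inj₂ (inj₁ refl) , doubled∈·Λ n 0 j j≤n ,
  cong₂ _,_ (sym (ℤP.+-identityˡ _)) (sym (2+2*n≡2*[1+n] j))
doubled∈·Λ (suc n) (suc i) j (s≤s i+j≤n) =
  _ , _ , inj₂ (inj₂ refl) , doubled∈·Λ n i j i+j≤n ,
  cong₂ _,_ (sym (2+2*n≡2*[1+n] i)) (sym (ℤP.+-identityˡ _))

chart-⊕-doubled : ∀ q p a b i j → chart q p a b ⊕ doubled i j ≡ chart q p (a + i) (b + j)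
chart-⊕-doubled q p a b i j = cong₂ _,_ (identity (+ q) (+ a) (+ i)) (identity (+ p) (+ b) (+ j))
  where
  identity : ∀ k a i → (ℤ.- k ℤ.+ + 2 ℤ.* a) ℤ.+ + 2 ℤ.* i ≡ ℤ.- k ℤ.+ + 2 ℤ.* (a ℤ.+ i)
  identity = ℤSolver.solve-∀

Polygon-+ : ∀ {q p n a b i j} → Polygon q p 0 a b → i + j ≤ n → Polygon q p n (a + i) (b + j)
Polygon-+ {q} {p} {n} {a} {b} {i} {j} (polygon a+b<N qp≤pa+qb) i+j≤n = polygon
  (begin-strict
    (a + i) + (b + j)  ≡⟨ interchange a i b j ⟩
    (a + b) + (i + j)  <⟨ +-mono-<-≤ a+b<N i+j≤n ⟩
    p + q + 0 + n      ≡⟨ cong (_+ n) (+-identityʳ (p + q)) ⟩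
    p + q + n          ∎)
  (≤-trans qp≤pa+qb (+-mono-≤ (*-monoʳ-≤ p (m≤m+n a i)) (*-monoʳ-≤ q (m≤m+n b j))))
  where
  open ≤-Reasoning
  interchange : ∀ a i b j → (a + i) + (b + j) ≡ (a + b) + (i + j)
  interchange = ℕSolver.solve-∀

+-≤-tight : ∀ {a b q p} → a ≤ q → b ≤ p → q + p ≤ a + b → a ≡ q × b ≡ p
+-≤-tight {a} {b} {q} {p} a≤q b≤p q+p≤a+b =
  ≤-antisym a≤q (+-cancelʳ-≤ p q a (≤-trans q+p≤a+b (+-monoʳ-≤ a b≤p))) ,
  ≤-antisym b≤p (+-cancelˡ-≤ q p b (≤-trans q+p≤a+b (+-monoˡ-≤ b a≤q)))

suc<+suc⇒< : ∀ {m} k n → suc m < k + suc n → m < k + n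
suc<+suc⇒< {m} k n h = ≤-pred (subst (suc (suc m) ≤_) (+-suc k n) h)

Polygon-below-corner : ∀ {q p n} → Coprime q p →
  (∃ λ a → q ≡ suc a × Polygon q p n a p) ⊎ (∃ λ b → p ≡ suc b × Polygon q p n q b)
Polygon-below-corner {suc a} {p} {n} _ =
  inj₁ (a , refl , polygon (≤-trans (≤-reflexive (suc-swap a p)) (m≤m+n (p + suc a) n)) (m≤n+m (suc a * p) (p * a)))
  where
  suc-swap : ∀ a p → suc (a + p) ≡ p + suc a
  suc-swap = ℕSolver.solve-∀
Polygon-below-corner {zero} coprime with 0-coprimeTo-m⇒m≡1 coprime
... | refl = inj₂ (0 , refl , polygon (s≤s z≤n) z≤n)

Polygon-peel : ∀ {q p n a b} → Coprime q p → Polygon q p (suc n) a b →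
  Polygon q p n a b ⊎
  (∃ λ a′ → a ≡ suc a′ × Polygon q p n a′ b) ⊎ (∃ λ b′ → b ≡ suc b′ × Polygon q p n a b′)
Polygon-peel {q} {p} {n} {a} {b} coprime (polygon a+b<N+1 qp≤pa+qb) with a + b <? p + q + n
... | yes a+b<N = inj₁ (polygon a+b<N qp≤pa+qb)
... | no a+b≮N with q <? a | p <? b
...   | yes (s≤s {n = a′} q≤a′) | _ =
  inj₂ (inj₁ (a′ , refl , polygon (suc<+suc⇒< (p + q) n a+b<N+1)
    (≤-trans (≤-reflexive (*-comm q p)) (≤-trans (*-monoʳ-≤ p q≤a′) (m≤m+n (p * a′) (q * b))))))
...   | no _ | yes (s≤s {n = b′} p≤b′) =
  inj₂ (inj₂ (b′ , refl , polygon (suc<+suc⇒< (p + q) n (subst (_< p + q + suc n) (+-suc a b′) a+b<N+1))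
    (≤-trans (*-monoʳ-≤ q p≤b′) (m≤n+m (q * b′) (p * a)))))
...   | no q≮a | no p≮b
  with +-≤-tight (≮⇒≥ q≮a) (≮⇒≥ p≮b) (≤-trans (≤-reflexive (+-comm q p)) (≤-trans (m≤m+n (p + q) n) (≮⇒≥ a+b≮N)))
...     | refl , refl with Polygon-below-corner {n = n} coprime
...       | inj₁ (a′ , refl , r) = inj₂ (inj₁ (a′ , refl , r))
...       | inj₂ (b′ , refl , r) = inj₂ (inj₂ (b′ , refl , r))

Polygon-split : ∀ {q p} n {a b} → Coprime q p → Polygon q p n a b →
  ∃₂ λ a₀ b₀ → ∃₂ λ i j → Polygon q p 0 a₀ b₀ × i + j ≤ n × a ≡ a₀ + i × b ≡ b₀ + j
Polygon-split zero {a} {b} _ r = a , b , 0 , 0 , r , z≤n , sym (+-identityʳ a) , sym (+-identityʳ b)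
Polygon-split (suc n) coprime r with Polygon-peel coprime r
... | inj₁ r′ with Polygon-split n coprime r′
...   | a₀ , b₀ , i , j , r₀ , i+j≤n , refl , refl = a₀ , b₀ , i , j , r₀ , m≤n⇒m≤1+n i+j≤n , refl , refl
Polygon-split (suc n) coprime r | inj₂ (inj₁ (a′ , refl , r′)) with Polygon-split n coprime r′
...   | a₀ , b₀ , i , j , r₀ , i+j≤n , refl , refl = a₀ , b₀ , suc i , j , r₀ , s≤s i+j≤n , sym (+-suc a₀ i) , refl
Polygon-split (suc n) coprime r | inj₂ (inj₂ (b′ , refl , r′)) with Polygon-split n coprime r′
...   | a₀ , b₀ , i , j , r₀ , i+j≤n , refl , refl =
  a₀ , b₀ , i , suc j , r₀ , subst (_≤ suc n) (sym (+-suc i j)) (s≤s i+j≤n) , refl , sym (+-suc b₀ j)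

J+nΛ⊆Polygon : ∀ q p n → (J q p +ₛ (n ·Λ)) ⊆ₛ ChartImage q p (Polygon q p n)
J+nΛ⊆Polygon q p n _ (u , v , u∈J , v∈nΛ , refl) with J⊆Polygon q p u u∈J | ·Λ⇒doubled n v∈nΛ
... | a , b , r , refl | i , j , i+j≤n , refl = a + i , b + j , Polygon-+ r i+j≤n , chart-⊕-doubled q p a b i j

Polygon⊆J+nΛ : ∀ q p n → Coprime q p → ChartImage q p (Polygon q p n) ⊆ₛ (J q p +ₛ (n ·Λ))
Polygon⊆J+nΛ q p n coprime _ (a , b , r , refl) with Polygon-split n coprime r
... | a₀ , b₀ , i , j , r₀ , i+j≤n , refl , refl =
  chart q p a₀ b₀ , doubled i j , Polygon⇒J q p r₀ , doubled∈·Λ n i j i+j≤n , sym (chart-⊕-doubled q p a₀ b₀ i j)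

Polygon₁-nearP : ∀ {q p i j} → i + j ≤ p → Polygon q p 1 (q + i) j
Polygon₁-nearP {q} {p} {i} {j} i+j≤p = polygon
  (≤-trans (≤-reflexive (cong suc (+-assoc q i j))) (≤-trans (s≤s (+-monoʳ-≤ q i+j≤p)) (≤-reflexive (reorder q p))))
  (≤-trans (≤-reflexive (*-comm q p)) (≤-trans (*-monoʳ-≤ p (m≤m+n q i)) (m≤m+n (p * (q + i)) (q * j))))
  where
  reorder : ∀ q p → suc (q + p) ≡ p + q + 1
  reorder = ℕSolver.solve-∀

Polygon₁-nearQ : ∀ {q p i j} → i + j ≤ q → Polygon q p 1 i (p + j)
Polygon₁-nearQ {q} {p} {i} {j} i+j≤q = polygon
  (≤-trans (≤-reflexive (cong suc (reorder₁ i p j))) (≤-trans (s≤s (+-monoʳ-≤ p i+j≤q)) (≤-reflexive (reorder₂ p q))))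
  (≤-trans (*-monoʳ-≤ q (m≤m+n p j)) (m≤n+m (q * (p + j)) (p * i)))
  where
  reorder₁ : ∀ i p j → i + (p + j) ≡ p + (i + j)
  reorder₁ = ℕSolver.solve-∀
  reorder₂ : ∀ p q → suc (p + q) ≡ p + q + 1
  reorder₂ = ℕSolver.solve-∀

P₀+pΛ⊆Polygon : ∀ q p → (P q p (+ 0) +ₚ (p ·Λ)) ⊆ₛ ChartImage q p (Polygon q p 1)
P₀+pΛ⊆Polygon q p _ (z , z∈pΛ , refl) with ·Λ⇒doubled p z∈pΛ
... | i , j , i+j≤p , refl = q + i , j , Polygon₁-nearP i+j≤p , (begin
  P q p (+ 0) ⊕ doubled i j          ≡⟨ cong (_⊕ doubled i j) (P≡chart q p 0) ⟩
  chart q p (q + 0) 0 ⊕ doubled i j  ≡⟨ chart-⊕-doubled q p (q + 0) 0 i j ⟩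
  chart q p (q + 0 + i) j            ≡⟨ cong (λ a → chart q p (a + i) j) (+-identityʳ q) ⟩
  chart q p (q + i) j                ∎)
  where open ≡-Reasoning

Q₀+qΛ⊆Polygon : ∀ q p → (Q q p (+ 0) +ₚ (q ·Λ)) ⊆ₛ ChartImage q p (Polygon q p 1)
Q₀+qΛ⊆Polygon q p _ (z , z∈qΛ , refl) with ·Λ⇒doubled q z∈qΛ
... | i , j , i+j≤q , refl = i , p + j , Polygon₁-nearQ i+j≤q , (begin
  Q q p (+ 0) ⊕ doubled i j          ≡⟨ cong (_⊕ doubled i j) (Q≡chart q p 0) ⟩
  chart q p 0 (p + 0) ⊕ doubled i j  ≡⟨ chart-⊕-doubled q p 0 (p + 0) i j ⟩
  chart q p i (p + 0 + j)            ≡⟨ cong (λ b → chart q p i (b + j)) (+-identityʳ p) ⟩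
  chart q p i (p + j)                ∎)
  where open ≡-Reasoning

moment : (ℕ × ℕ → ℕ) → List (ℕ × ℕ × ℕ) → ℕ
moment f = foldr (λ t acc → proj₁ t * f (proj₂ t) + acc) 0

Barycentre : (ℕ → ℕ → Set) → ℕ → ℕ → Set
Barycentre G a b = ∃ λ (L : List (ℕ × ℕ × ℕ)) → All (uncurry G ∘ proj₂) L ×
  ∃ λ d → mass L ≡ suc d × moment proj₁ L ≡ suc d * a × moment proj₂ L ≡ suc d * b

mass-map₂ : ∀ {A B : Set} (g : A → B) L → mass (map (map₂ g) L) ≡ mass L
mass-map₂ g [] = refl
mass-map₂ g ((c , _) ∷ L) = cong (_+_ c) (mass-map₂ g L)

moment-map₂ : ∀ f g L → moment f (map (map₂ g) L) ≡ moment (f ∘ g) L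
moment-map₂ f g [] = refl
moment-map₂ f g ((c , xy) ∷ L) = cong (_+_ (c * f (g xy))) (moment-map₂ f g L)

Barycentre-swap : ∀ {G H : ℕ → ℕ → Set} {a b} → (∀ {x y} → G x y → H y x) → Barycentre G a b → Barycentre H b a
Barycentre-swap G⇒H (L , gens , d , mass≡ , moment₁≡ , moment₂≡) =
  map (map₂ swap) L , All.map⁺ (All.map G⇒H gens) , d ,
  trans (mass-map₂ swap L) mass≡ ,
  trans (moment-map₂ proj₁ swap L) moment₂≡ ,
  trans (moment-map₂ proj₂ swap L) moment₁≡

Barycentre-point : ∀ {G : ℕ → ℕ → Set} {a b} → G a b → Barycentre G a b
Barycentre-point {a = a} {b} Gab =
  (1 , a , b) ∷ [] , Gab ∷ [] , 0 , refl , +-identityʳ (1 * a) , +-identityʳ (1 * b)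

Barycentre-segment : ∀ {G : ℕ → ℕ → Set} {a b s} → a + b ≡ suc s →
  G (suc s) 0 → G 0 (suc s) → Barycentre G a b
Barycentre-segment {a = a} {b} {s} a+b≡ Gs0 G0s =
  (a , suc s , 0) ∷ (b , 0 , suc s) ∷ [] , Gs0 ∷ G0s ∷ [] , s ,
  trans (cong (_+_ a) (+-identityʳ b)) a+b≡ , along₁ a b (suc s) , along₂ a b (suc s)
  where
  along₁ : ∀ a b s → a * s + (b * 0 + 0) ≡ s * a
  along₁ = ℕSolver.solve-∀
  along₂ : ∀ a b s → a * 0 + (b * s + 0) ≡ s * b
  along₂ = ℕSolver.solve-∀

-- The weights t and e are truncated differences, so they enter only through their defining
-- equations and the identities are proved after adding back what was subtracted.
triangle-mass : ∀ {q} a f p m b t e → q ≡ a + f →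
  (p + m) * f ≡ q * b + t → p * a + q * b ≡ q * p + e →
  a * m + (t + (e + 0)) ≡ q * m
triangle-mass a f p m b t e refl ht he = +-cancelʳ-≡ (q * b + q * p) _ _ (begin
  a * m + (t + (e + 0)) + (q * b + q * p)   ≡⟨ regroup a f p m b t e ⟩
  a * m + (q * b + t) + (q * p + e)         ≡⟨ cong₂ (λ x y → a * m + x + y) ht he ⟨
  a * m + (p + m) * f + (p * a + q * b)     ≡⟨ expand a f p m b ⟩
  q * m + (q * b + q * p)                   ∎)
  where
  open ≡-Reasoning
  q = a + f
  regroup : ∀ a f p m b t e → a * m + (t + (e + 0)) + ((a + f) * b + (a + f) * p)
                            ≡ a * m + ((a + f) * b + t) + ((a + f) * p + e)
  regroup = ℕSolver.solve-∀
  expand : ∀ a f p m b → a * m + (p + m) * f + (p * a + (a + f) * b)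
                       ≡ (a + f) * m + ((a + f) * b + (a + f) * p)
  expand = ℕSolver.solve-∀

triangle-moment₂ : ∀ {q} a f p m b t e → q ≡ a + f →
  (p + m) * f ≡ q * b + t → p * a + q * b ≡ q * p + e →
  a * m * 0 + (t * p + (e * (p + m) + 0)) ≡ q * m * b
triangle-moment₂ a f p m b t e refl ht he = +-cancelʳ-≡ (p * (q * b) + (p + m) * (q * p)) _ _ (begin
  a * m * 0 + (t * p + (e * (p + m) + 0)) + (p * (q * b) + (p + m) * (q * p))
    ≡⟨ regroup a f p m b t e ⟩
  p * (q * b + t) + (p + m) * (q * p + e)
    ≡⟨ cong₂ (λ x y → p * x + (p + m) * y) ht he ⟨
  p * ((p + m) * f) + (p + m) * (p * a + q * b)
    ≡⟨ expand a f p m b ⟩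
  q * m * b + (p * (q * b) + (p + m) * (q * p))
    ∎)
  where
  open ≡-Reasoning
  q = a + f
  regroup : ∀ a f p m b t e →
    a * m * 0 + (t * p + (e * (p + m) + 0)) + (p * ((a + f) * b) + (p + m) * ((a + f) * p))
    ≡ p * ((a + f) * b + t) + (p + m) * ((a + f) * p + e)
  regroup = ℕSolver.solve-∀
  expand : ∀ a f p m b → p * ((p + m) * f) + (p + m) * (p * a + (a + f) * b)
                       ≡ (a + f) * m * b + (p * ((a + f) * b) + (p + m) * ((a + f) * p))
  expand = ℕSolver.solve-∀

-- (a, b) = (a m · (q, 0) + t · (0, p) + e · (0, p + m)) / (q m) with m = q − 1,
-- t = (p + m)(q − a) − q b and e = p a + q b − q p; these weights are natural numbers
-- because p ≥ 1, a + b ≤ q and (a, b) lies on the far side of the inner edge.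
Barycentre-triangle : ∀ {G : ℕ → ℕ → Set} {q p a b} → 1 < q → 0 < p →
  a + b ≤ q → q * p ≤ p * a + q * b →
  G q 0 → G 0 p → G 0 (p + pred q) → Barycentre G a b
Barycentre-triangle {q = suc m} {suc p′} {a} {b} (s≤s (s≤s z≤n)) (s≤s z≤n) a+b≤q qp≤pa+qb Gq0 G0p G0p+m =
  (a * m , q , 0) ∷ (t , 0 , p) ∷ (e , 0 , p + m) ∷ [] ,
  Gq0 ∷ G0p ∷ G0p+m ∷ [] ,
  _ , triangle-mass a f p m b t e q≡a+f ht he , vertex a m q t e , triangle-moment₂ a f p m b t e q≡a+f ht he
  where
  q = suc m
  p = suc p′
  f = q ∸ a
  q≡a+f : q ≡ a + f
  q≡a+f = sym (m+[n∸m]≡n (m+n≤o⇒m≤o a a+b≤q))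
  b≤f : b ≤ f
  b≤f = +-cancelˡ-≤ a b f (subst (a + b ≤_) q≡a+f a+b≤q)
  t = (p + m) * f ∸ q * b
  ht : (p + m) * f ≡ q * b + t
  ht = sym (m+[n∸m]≡n (*-mono-≤ (s≤s (m≤n+m m p′)) b≤f))
  e = p * a + q * b ∸ q * p
  he : p * a + q * b ≡ q * p + e
  he = sym (m+[n∸m]≡n qp≤pa+qb)
  vertex : ∀ a m q t e → a * m * q + (t * 0 + (e * 0 + 0)) ≡ q * m * a
  vertex = ℕSolver.solve-∀

momentℤ-offset : ∀ (π : Pt → ℤ) k (f : ℕ × ℕ → ℕ) (g : ℕ × ℕ → Pt) →
  (∀ xy → π (g xy) ≡ offset k (f xy)) →
  ∀ L → momentℤ π (map (map₂ g) L) ≡ ℤ.- + k ℤ.* + mass L ℤ.+ + 2 ℤ.* + moment f L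
momentℤ-offset π k f g π∘g≡ [] = sym (trans (ℤP.+-identityʳ _) (ℤP.*-zeroʳ (ℤ.- + k)))
momentℤ-offset π k f g π∘g≡ ((c , xy) ∷ L) = begin
  + c ℤ.* π (g xy) ℤ.+ momentℤ π (map (map₂ g) L)
    ≡⟨ cong₂ (λ s t → + c ℤ.* s ℤ.+ t) (π∘g≡ xy) (momentℤ-offset π k f g π∘g≡ L) ⟩
  + c ℤ.* offset k (f xy) ℤ.+ (ℤ.- + k ℤ.* + mass L ℤ.+ + 2 ℤ.* + moment f L)
    ≡⟨ distribute (+ k) (+ c) (+ f xy) (+ mass L) (+ moment f L) ⟩
  ℤ.- + k ℤ.* (+ c ℤ.+ + mass L) ℤ.+ + 2 ℤ.* (+ c ℤ.* + f xy ℤ.+ + moment f L)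
    ≡⟨ cong (λ s → ℤ.- + k ℤ.* (+ c ℤ.+ + mass L) ℤ.+ + 2 ℤ.* (s ℤ.+ + moment f L)) (ℤP.pos-* c (f xy)) ⟨
  ℤ.- + k ℤ.* + (c + mass L) ℤ.+ + 2 ℤ.* + (c * f xy + moment f L)
    ∎
  where
  open ≡-Reasoning
  distribute : ∀ k c x M S → c ℤ.* (ℤ.- k ℤ.+ + 2 ℤ.* x) ℤ.+ (ℤ.- k ℤ.* M ℤ.+ + 2 ℤ.* S)
                           ≡ ℤ.- k ℤ.* (c ℤ.+ M) ℤ.+ + 2 ℤ.* (c ℤ.* x ℤ.+ S)
  distribute = ℤSolver.solve-∀

Barycentre⇒ConvHull : ∀ {U : PSet} {G : ℕ → ℕ → Set} q p {a b} →
  (∀ {x y} → G x y → U (chart q p x y)) → Barycentre G a b → ConvHull U (chart q p a b)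
Barycentre⇒ConvHull q p G⇒U (L , gens , d , mass≡ , moment₁≡ , moment₂≡) =
  barycentre∈ConvHull charted d (All.map⁺ (All.map G⇒U gens)) (trans (mass-map₂ _ L) mass≡)
    (coordinate proj₁ q proj₁ (λ _ → refl) moment₁≡)
    (coordinate proj₂ p proj₂ (λ _ → refl) moment₂≡)
  where
  charted : List (ℕ × Pt)
  charted = map (map₂ (uncurry (chart q p))) L
  factor : ∀ k D c → ℤ.- k ℤ.* D ℤ.+ + 2 ℤ.* (D ℤ.* c) ≡ D ℤ.* (ℤ.- k ℤ.+ + 2 ℤ.* c)
  factor = ℤSolver.solve-∀
  coordinate : ∀ π k f {c} → (∀ xy → π (uncurry (chart q p) xy) ≡ offset k (f xy)) →
    moment f L ≡ suc d * c → momentℤ π charted ≡ + suc d ℤ.* offset k c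
  coordinate π k f {c} π≡ moment≡ = begin
    momentℤ π charted                                        ≡⟨ momentℤ-offset π k f _ π≡ L ⟩
    ℤ.- + k ℤ.* + mass L ℤ.+ + 2 ℤ.* + moment f L            ≡⟨ cong₂ (λ M S → ℤ.- + k ℤ.* + M ℤ.+ + 2 ℤ.* + S) mass≡ moment≡ ⟩
    ℤ.- + k ℤ.* + suc d ℤ.+ + 2 ℤ.* + (suc d * c)            ≡⟨ cong (λ s → ℤ.- + k ℤ.* + suc d ℤ.+ + 2 ℤ.* s) (ℤP.pos-* (suc d) c) ⟩
    ℤ.- + k ℤ.* + suc d ℤ.+ + 2 ℤ.* (+ suc d ℤ.* + c)        ≡⟨ factor (+ k) (+ suc d) (+ c) ⟩
    + suc d ℤ.* offset k c                                   ∎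
    where open ≡-Reasoning

AxisPoint : ℕ → ℕ → ℕ → ℕ → ℕ → Set
AxisPoint q p n x y = (y ≡ 0 × q ≤ x × x < p + q + n) ⊎ (x ≡ 0 × p ≤ y × y < p + q + n)

AxisPoint-swap : ∀ {q p n x y} → AxisPoint p q n y x → AxisPoint q p n x y
AxisPoint-swap {q} {p} {n} {y = y} (inj₁ (x≡0 , p≤y , y<N)) =
  inj₂ (x≡0 , p≤y , subst (y <_) (cong (_+ n) (+-comm q p)) y<N)
AxisPoint-swap {q} {p} {n} {x} (inj₂ (y≡0 , q≤x , x<N)) =
  inj₁ (y≡0 , q≤x , subst (x <_) (cong (_+ n) (+-comm q p)) x<N)

Polygon-swap : ∀ {q p n a b} → Polygon q p n a b → Polygon p q n b a
Polygon-swap {q} {p} {n} {a} {b} (polygon a+b<N qp≤pa+qb) = polygon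
  (subst₂ _<_ (+-comm a b) (cong (_+ n) (+-comm p q)) a+b<N)
  (subst₂ _≤_ (*-comm q p) (+-comm (p * a) (q * b)) qp≤pa+qb)

Polygon-origin : ∀ {q p n} → Polygon q p n 0 0 → AxisPoint q p n 0 0
Polygon-origin {q} {p} (polygon 0<N qp≤0)
  with m*n≡0⇒m≡0∨n≡0 q (n≤0⇒n≡0 (subst (q * p ≤_) (cong₂ _+_ (*-zeroʳ p) (*-zeroʳ q)) qp≤0))
... | inj₁ refl = inj₁ (refl , z≤n , 0<N)
... | inj₂ refl = inj₂ (refl , z≤n , 0<N)

coprime-1<⇒0< : ∀ {q p} → Coprime q p → 1 < q → 0 < p
coprime-1<⇒0< {p = suc _} _ _ = s≤s z≤n
coprime-1<⇒0< {p = zero} coprime 1<q with 0-coprimeTo-m⇒m≡1 (Coprimality.sym coprime)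
... | refl = contradiction 1<q (<-irrefl refl)

Polygon⇒Barycentre-<q : ∀ {q p n a b s} → Coprime q p → Polygon q p n a b →
  a + b ≡ suc s → a + b < q → Barycentre (AxisPoint q p n) a b
Polygon⇒Barycentre-<q {q} {p} {n} coprime (polygon _ qp≤pa+qb) a+b≡ a+b<q =
  Barycentre-triangle 1<q 0<p (<⇒≤ a+b<q) qp≤pa+qb
    (inj₁ (refl , ≤-refl , within (m<n+m q 0<p)))
    (inj₂ (refl , ≤-refl , within (m<m+n p 0<q)))
    (inj₂ (refl , m≤m+n p (pred q) , within (+-monoʳ-< p (≤-reflexive (suc-pred q {{ℕ.>-nonZero 0<q}})))))
  where
  1<q : 1 < q
  1<q = ≤-trans (s≤s (subst (1 ≤_) (sym a+b≡) (s≤s z≤n))) a+b<q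
  0<q : 0 < q
  0<q = <-trans (s≤s z≤n) 1<q
  0<p : 0 < p
  0<p = coprime-1<⇒0< coprime 1<q
  within : ∀ {x} → x < p + q → x < p + q + n
  within x<p+q = ≤-trans x<p+q (m≤m+n (p + q) n)

Polygon⇒Barycentre⁺ : ∀ {q p n a b s} → Coprime q p → Polygon q p n a b →
  a + b ≡ suc s → Barycentre (AxisPoint q p n) a b
Polygon⇒Barycentre⁺ {q} {p} {n} {a} {b} {s} coprime r@(polygon a+b<N _) a+b≡ with q ≤? suc s | p ≤? suc s
... | yes q≤s | yes p≤s =
  Barycentre-segment a+b≡ (inj₁ (refl , q≤s , s<N)) (inj₂ (refl , p≤s , s<N))
  where s<N = subst (_< p + q + n) a+b≡ a+b<N
... | no q≰s | _ = Polygon⇒Barycentre-<q coprime r a+b≡ (subst (_< q) (sym a+b≡) (≰⇒> q≰s))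
... | yes _ | no p≰s =
  Barycentre-swap AxisPoint-swap
    (Polygon⇒Barycentre-<q (Coprimality.sym coprime) (Polygon-swap r) b+a≡ (subst (_< p) (sym b+a≡) (≰⇒> p≰s)))
  where b+a≡ = trans (+-comm b a) a+b≡

Polygon⇒Barycentre : ∀ {q p n} a b → Coprime q p → Polygon q p n a b → Barycentre (AxisPoint q p n) a b
Polygon⇒Barycentre zero    zero    _       r = Barycentre-point (Polygon-origin r)
Polygon⇒Barycentre (suc a) b       coprime r = Polygon⇒Barycentre⁺ coprime r refl
Polygon⇒Barycentre zero    (suc b) coprime r = Polygon⇒Barycentre⁺ coprime r refl

Gen⇒AxisPoint : ∀ {q p n} → Gen q p n ⊆ₛ ChartImage q p (AxisPoint q p n)
Gen⇒AxisPoint {q} {p} {n} _ (inj₁ (+ k , _ , ℤ.+<+ k<p+n , refl)) =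
  q + k , 0 , inj₁ (refl , m≤m+n q k , subst (q + k <_) (shuffle q p n) (+-monoʳ-< q k<p+n)) , P≡chart q p k
  where
  shuffle : ∀ q p n → q + (p + n) ≡ p + q + n
  shuffle = ℕSolver.solve-∀
Gen⇒AxisPoint {q} {p} {n} _ (inj₂ (+ k , _ , ℤ.+<+ k<q+n , refl)) =
  0 , p + k , inj₂ (refl , m≤m+n p k , subst (p + k <_) (sym (+-assoc p q n)) (+-monoʳ-< p k<q+n)) , Q≡chart q p k

AxisPoint⇒Gen : ∀ {q p n x y} → AxisPoint q p n x y → Gen q p n (chart q p x y)
AxisPoint⇒Gen {q} {p} {n} (inj₁ (refl , q≤x , x<N)) with m≤n⇒∃[o]m+o≡n q≤x
... | k , refl =
  inj₁ (+ k , ℤ.+≤+ z≤n , ℤ.+<+ (+-cancelˡ-< q k (p + n) (subst (q + k <_) (shuffle q p n) x<N)) , sym (P≡chart q p k))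
  where
  shuffle : ∀ q p n → p + q + n ≡ q + (p + n)
  shuffle = ℕSolver.solve-∀
AxisPoint⇒Gen {q} {p} {n} (inj₂ (refl , p≤y , y<N)) with m≤n⇒∃[o]m+o≡n p≤y
... | k , refl =
  inj₂ (+ k , ℤ.+≤+ z≤n , ℤ.+<+ (+-cancelˡ-< p k (q + n) (subst (p + k <_) (+-assoc p q n) y<N)) , sym (Q≡chart q p k))

AxisPoint⇒Polygon : ∀ {q p n x y} → AxisPoint q p n x y → Polygon q p n x y
AxisPoint⇒Polygon {q} {p} {n} {x} (inj₁ (refl , q≤x , x<N)) = polygon
  (subst (_< p + q + n) (sym (+-identityʳ x)) x<N)
  (≤-trans (≤-reflexive (*-comm q p)) (≤-trans (*-monoʳ-≤ p q≤x) (m≤m+n (p * x) (q * 0))))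
AxisPoint⇒Polygon {q} {p} {y = y} (inj₂ (refl , p≤y , y<N)) = polygon
  y<N (≤-trans (*-monoʳ-≤ q p≤y) (m≤n+m (q * y) (p * 0)))

Polygon⊆⟨Gen⟩ : ∀ q p n → Coprime q p → ChartImage q p (Polygon q p n) ⊆ₛ ⟨ Gen q p n ⟩[ q , p ]
Polygon⊆⟨Gen⟩ q p n coprime _ (a , b , r , refl) =
  (offset-≡₂ q a , offset-≡₂ p b) , Barycentre⇒ConvHull q p AxisPoint⇒Gen (Polygon⇒Barycentre a b coprime r)

ConvHull-Gen-lowerBound : ∀ q p n u v c {α β} →
  (∀ {x y} → Polygon q p n x y → c ℤ.≤ linearForm u v (chart q p x y)) →
  ConvHull (Gen q p n) (α , β) → c ℤ.≤ linearForm u v (α , β)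
ConvHull-Gen-lowerBound q p n u v c onPolygon = ConvHull-lowerBound u v c onGen
  where
  onGen : ∀ g → Gen q p n g → c ℤ.≤ linearForm u v g
  onGen g g∈Gen with Gen⇒AxisPoint g g∈Gen
  ... | x , y , axis , refl = onPolygon (AxisPoint⇒Polygon axis)

⟨Gen⟩⊆Polygon : ∀ q p n → ⟨ Gen q p n ⟩[ q , p ] ⊆ₛ ChartImage q p (Polygon q p n)
⟨Gen⟩⊆Polygon q p n (α , β) ((α≡₂q , β≡₂p) , hull) =
  inChart (offset-surjective q α≡₂q -q≤α) (offset-surjective p β≡₂p -p≤β)
  where
  bound : ∀ u v c → (∀ {x y} → Polygon q p n x y → c ℤ.≤ linearForm u v (chart q p x y)) →
          c ℤ.≤ linearForm u v (α , β)
  bound u v c onPolygon = ConvHull-Gen-lowerBound q p n u v c onPolygon hull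
  first : ∀ a b → + 1 ℤ.* a ℤ.+ + 0 ℤ.* b ≡ a
  first = ℤSolver.solve-∀
  second : ∀ a b → + 0 ℤ.* a ℤ.+ + 1 ℤ.* b ≡ b
  second = ℤSolver.solve-∀
  negatedSum : ∀ a b → ℤ.- + 1 ℤ.* a ℤ.+ ℤ.- + 1 ℤ.* b ≡ ℤ.- (a ℤ.+ b)
  negatedSum = ℤSolver.solve-∀
  -q≤α : ℤ.- + q ℤ.≤ α
  -q≤α = subst (ℤ.- + q ℤ.≤_) (first α β) (bound (+ 1) (+ 0) (ℤ.- + q) λ {x} {y} _ →
    subst (ℤ.- + q ℤ.≤_) (sym (first (offset q x) (offset p y))) (offset-lowerBound q x))
  -p≤β : ℤ.- + p ℤ.≤ β
  -p≤β = subst (ℤ.- + p ℤ.≤_) (second α β) (bound (+ 0) (+ 1) (ℤ.- + p) λ {x} {y} _ →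
    subst (ℤ.- + p ℤ.≤_) (sym (second (offset q x) (offset p y))) (offset-lowerBound p y))
  B = (+ p ℤ.+ + q) ℤ.- + 2 ℤ.+ + 2 ℤ.* + n
  outerBound : OuterBound q p n (α , β)
  outerBound = ℤP.neg-cancel-≤ (subst (ℤ.- B ℤ.≤_) (negatedSum α β) (bound (ℤ.- + 1) (ℤ.- + 1) (ℤ.- B) λ {x} {y} r →
    subst (ℤ.- B ℤ.≤_) (sym (negatedSum (offset q x) (offset p y)))
      (ℤP.neg-mono-≤ (from (chart-OuterBound q p n x y) (Polygon.outer r)))))
  innerBound : InnerBound q p (α , β)
  innerBound = bound (+ p) (+ q) (+ 0) λ {x} {y} r → from (chart-InnerBound q p x y) (Polygon.inner r)
  inChart : (∃ λ a → α ≡ offset q a) → (∃ λ b → β ≡ offset p b) → ChartImage q p (Polygon q p n) (α , β)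
  inChart (a , α≡) (b , β≡) =
    a , b , polygon (to (chart-OuterBound q p n a b) (subst (OuterBound q p n) αβ≡ outerBound))
                    (to (chart-InnerBound q p a b) (subst (InnerBound q p) αβ≡ innerBound)) , αβ≡
    where αβ≡ = cong₂ _,_ α≡ β≡

corollary3p2 : (p q : ℕ) → Coprime q p → (n : ℕ) →
    ((J q p +ₛ (n ·Λ)) ≐ ⟨ Gen q p n ⟩[ q , p ])
    × (((P q p (+ 0) +ₚ (p ·Λ)) ∪ₛ (Q q p (+ 0) +ₚ (q ·Λ))) ⊆ₛ (J q p +ₛ (1 ·Λ)))
corollary3p2 p q coprime n =
  ((λ x → Polygon⊆⟨Gen⟩ q p n coprime x ∘ J+nΛ⊆Polygon q p n x) ,
   (λ x → Polygon⊆J+nΛ q p n coprime x ∘ ⟨Gen⟩⊆Polygon q p n x)) ,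
  λ { x (inj₁ x∈P₀+pΛ) → Polygon⊆J+nΛ q p 1 coprime x (P₀+pΛ⊆Polygon q p x x∈P₀+pΛ)
    ; x (inj₂ x∈Q₀+qΛ) → Polygon⊆J+nΛ q p 1 coprime x (Q₀+qΛ⊆Polygon q p x x∈Q₀+qΛ) }
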